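{- Let $n\ge 3$ and let $\varphi(\mathbf{x},\mathbf{y})$ be a P-encoding with input variables $\mathbf{x}=(x_1,\dots,x_n)$. Suppose that for some $i$ we have $|Q_{\varphi,i}|=1$. Then there is another P-encoding $\varphi'$ with input variables $\mathbf{x}$ satisfying $|\varphi|\ge|\varphi'|+1$. Moreover, if $\varphi$ is a 2-CNF formula, then so is $\varphi'$.
   Context: A CNF formula is a conjunction (set) of clauses (disjunctions of literals with no complementary pair); its size $|\varphi|$ is its number of clauses; a 2-CNF formula has all clauses of at most two literals. Unit resolution: from a unit clause $l$ and a clause containing $\neg l$ derive the clause with $\neg l$ removed; $\varphi\wedge g\vdash_1 h$ means the literal $h$ is derivable from $\varphi$ and the unit clause $g$ by a sequence of unit resolutions. A CNF formula $\varphi(\mathbf{x},\mathbf{y})$ with input variables $x_1,\dots,x_n$ and auxiliary variables $\mathbf{y}$ is a P-encoding if (P1) $\varphi\wedge x_i$ is satisfiable for each $i$ and (P2) $\varphi\wedge x_i\vdash_1\neg x_j$ for all $i\ne j$. $Q_{\varphi,i}=\{C\in\varphi:\neg x_i\in C\}$. -}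

module Defs where

open import Data.Nat using (ℕ; _≤_; _+_)
open import Data.Fin using (Fin)
open import Data.Bool using (Bool; true; false; not)
open import Data.Sum using (_⊎_; inj₁; inj₂)
open import Data.Product using (Σ; ∃; _×_; _,_)
open import Data.List using (List; []; _∷_; [_]; length; filter)
open import Data.List.Membership.Propositional using (_∈_)
open import Data.List.Relation.Unary.All using (All)
open import Data.List.Relation.Unary.Any using (Any)
open import Data.List.Relation.Unary.Unique.Propositional using (Unique)
open import Data.List.Relation.Unary.AllPairs using (AllPairs)
open import Relation.Nullary using (¬_; Dec; yes; no; ¬?)
import Data.List.Membership.DecPropositional as DecMem
open import Relation.Nullary.Decidable using (map′)
open import Relation.Binary.PropositionalEquality using (_≡_; refl; cong)
import Data.Sum.Properties as SumP
import Data.Fin.Properties as FinP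
import Data.Nat.Properties as NatP

-- Variables: input variables x₁..xₙ are 'inj₁ i' (i : Fin n);
-- auxiliary variables are 'inj₂ k' (k : ℕ), an unbounded supply.
Var : ℕ → Set
Var n = Fin n ⊎ ℕ

data Lit (n : ℕ) : Set where
  pos : Var n → Lit n
  neg : Var n → Lit n

compl : ∀ {n} → Lit n → Lit n
compl (pos v) = neg v
compl (neg v) = pos v

_≟V_ : ∀ {n} → (u v : Var n) → Dec (u ≡ v)
_≟V_ = SumP.≡-dec FinP._≟_ NatP._≟_

pos-inj : ∀ {n} {u v : Var n} → pos u ≡ pos v → u ≡ v
pos-inj refl = refl

neg-inj : ∀ {n} {u v : Var n} → neg u ≡ neg v → u ≡ v
neg-inj refl = refl

_≟L_ : ∀ {n} → (a b : Lit n) → Dec (a ≡ b)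
pos u ≟L pos v = map′ (cong pos) pos-inj (u ≟V v)
pos u ≟L neg v = no λ ()
neg u ≟L pos v = no λ ()
neg u ≟L neg v = map′ (cong neg) neg-inj (u ≟V v)

Clause : ℕ → Set
Clause n = List (Lit n)

CNF : ℕ → Set
CNF n = List (Clause n)

_⊆C_ : ∀ {n} → Clause n → Clause n → Set
C ⊆C D = ∀ {l} → l ∈ C → l ∈ D

SameSet : ∀ {n} → Clause n → Clause n → Set
SameSet C D = (C ⊆C D) × (D ⊆C C)

WFClause : ∀ {n} → Clause n → Set
WFClause C = Unique C × (∀ {l} → l ∈ C → ¬ (compl l ∈ C))

-- A well-formed CNF: a genuine set of well-formed clauses
-- (no two list entries denote the same clause), so |φ| = length φ.
WF : ∀ {n} → CNF n → Set
WF φ = All WFClause φ × AllPairs (λ C D → ¬ SameSet C D) φ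

size : ∀ {n} → CNF n → ℕ
size = length

remove : ∀ {n} → Lit n → Clause n → Clause n
remove l C = filter (λ m → ¬? (m ≟L l)) C

data Derives {n} (ψ : CNF n) : Clause n → Set where
  axiom   : ∀ {C} → C ∈ ψ → Derives ψ C
  resolve : ∀ {l C} → Derives ψ [ l ] → Derives ψ C → compl l ∈ C →
            Derives ψ (remove (compl l) C)

_∧_⊢₁_ : ∀ {n} → CNF n → Lit n → Lit n → Set
φ ∧ g ⊢₁ h = Derives ([ g ] ∷ φ) [ h ]

Assignment : ℕ → Set
Assignment n = Var n → Bool

evalLit : ∀ {n} → Assignment n → Lit n → Bool
evalLit α (pos v) = α v
evalLit α (neg v) = not (α v)

Satisfies : ∀ {n} → Assignment n → CNF n → Set
Satisfies α φ = All (λ C → Any (λ l → evalLit α l ≡ true) C) φ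

SatWith : ∀ {n} → CNF n → Lit n → Set
SatWith φ g = ∃ λ α → Satisfies α ([ g ] ∷ φ)

x : ∀ {n} → Fin n → Lit n
x i = pos (inj₁ i)

IsPEncoding : ∀ {n} → CNF n → Set
IsPEncoding {n} φ =
  (∀ (i : Fin n) → SatWith φ (x i)) ×
  (∀ (i j : Fin n) → ¬ (i ≡ j) → φ ∧ x i ⊢₁ compl (x j))

Q : ∀ {n} → CNF n → Fin n → CNF n
Q φ i = filter (λ C → DecMem._∈?_ _≟L_ (compl (x i)) C) φ

Is2CNF : ∀ {n} → CNF n → Set
Is2CNF φ = All (λ C → length C ≤ 2) φ

module Submission where

-- Unit propagation is represented by proof trees ψ ⊩ h, shown equivalent to the
-- unit-resolution derivations of the statement (⊩⇒derives, derives⇒⊩); soundness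
-- makes a satisfiable formula propagate no complementary pair.
--
-- Since xᵢ must propagate some ¬xⱼ, and φ alone cannot, the propagation passes
-- through C: a literal l ∈ C, l ≠ ¬xᵢ, is propagated from xᵢ (witness-exists).
-- After xᵢ, everything follows from l alone (reroute), so with n ≥ 3 the literal
-- l cannot be an input literal and is auxiliary (witness-aux).  Substituting xᵢ
-- for l, dropping C, discarding tautologies and merging duplicate literals and
-- clauses gives φ′ (Elimination).  Every propagation of φ is mirrored in φ′
-- (simulate), and every model of φ ∧ xₖ yields one of φ′ ∧ xₖ by giving xᵢ the
-- value of l (Model); φ′ has lost C, and no clause grew longer.

open import Defs
open import Data.Bool using (true; false; not)
open import Data.Empty using (⊥; ⊥-elim)
open import Data.Fin using (Fin)
import Data.Fin as Fin
open import Data.List using (List; []; _∷_; [_]; length; filter; map; foldr; deduplicate)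
import Data.List.Properties as ListP
open import Data.List.Membership.Propositional using (_∈_; _∉_; find; lose)
open import Data.List.Membership.Propositional.Properties
  using (∈-filter⁺; ∈-filter⁻; ∈-map⁺; ∈-map⁻; ∈-deduplicate⁻; ∈-deduplicate⁺)
import Data.List.Membership.DecPropositional as DecMembership
open import Data.List.Relation.Binary.Subset.DecPropositional using (_⊆?_)
open import Data.List.Relation.Unary.All as All using (All; []; _∷_)
open import Data.List.Relation.Unary.AllPairs using ([]; _∷_)
open import Data.List.Relation.Unary.Any using (Any; here; there; any?)
import Data.List.Relation.Unary.Any as Any
import Data.List.Relation.Unary.Any.Properties as AnyP
open import Data.List.Relation.Unary.Unique.Propositional using (Unique)
import Data.List.Relation.Unary.Unique.Propositional.Properties as UniqueP
import Data.List.Relation.Unary.Unique.DecPropositional.Properties as UniqueDP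
import Data.List.Relation.Unary.Unique.DecSetoid.Properties as UniqueDS
open import Data.Nat using (ℕ; suc; _≤_; _+_; s≤s)
import Data.Nat.Properties as ℕP
open import Data.Product using (Σ; ∃; _×_; _,_; proj₁; proj₂)
open import Data.Sum using (_⊎_; inj₁; inj₂; [_,_]′)
import Data.Sum as Sum
import Data.Sum.Effectful.Right as SumRight
open import Function using (_∘_; id)
open import Level using (0ℓ)
open import Relation.Binary.Bundles using (DecSetoid)
open import Relation.Binary.PropositionalEquality
  using (_≡_; _≢_; refl; sym; trans; cong; subst; module ≡-Reasoning)
open import Relation.Nullary using (¬_; Dec; yes; no; ¬?)
open import Relation.Nullary.Decidable using (_×-dec_)
open import Relation.Unary using (Decidable)

compl-involutive : ∀ {n} (m : Lit n) → compl (compl m) ≡ m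
compl-involutive (pos v) = refl
compl-involutive (neg v) = refl

compl-injective : ∀ {n} {a b : Lit n} → compl a ≡ compl b → a ≡ b
compl-injective {a = a} {b} e =
  trans (sym (compl-involutive a)) (trans (cong compl e) (compl-involutive b))

compl-≢ : ∀ {n} (m : Lit n) → compl m ≢ m
compl-≢ (pos v) ()
compl-≢ (neg v) ()

evalLit-compl : ∀ {n} (α : Assignment n) (m : Lit n) → evalLit α (compl m) ≡ not (evalLit α m)
evalLit-compl α (pos v) = refl
evalLit-compl α (neg v) with α v
... | true  = refl
... | false = refl

var : ∀ {n} → Lit n → Var n
var (pos v) = v
var (neg v) = v

var-compl : ∀ {n} (m : Lit n) → var (compl m) ≡ var m
var-compl (pos v) = refl
var-compl (neg v) = refl

IsAux : ∀ {n} → Lit n → Set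
IsAux {n} l = ∀ (k : Fin n) → var l ≢ inj₁ k

infix 4 _⊩_
data _⊩_ {n} (ψ : CNF n) : Lit n → Set where
  fire : ∀ {A h} → A ∈ ψ → h ∈ A → (∀ {m} → m ∈ A → m ≢ h → ψ ⊩ compl m) → ψ ⊩ h

⊩-unit : ∀ {n} {φ : CNF n} (g : Lit n) → [ g ] ∷ φ ⊩ g
⊩-unit g = fire (here refl) (here refl) λ { (here refl) g≢g → ⊥-elim (g≢g refl) }

⊩-weaken : ∀ {n} {φ ψ : CNF n} {h} → (∀ {A} → A ∈ φ → A ∈ ψ) → φ ⊩ h → ψ ⊩ h
⊩-weaken φ⊆ψ (fire A∈ h∈ premises) =
  fire (φ⊆ψ A∈) h∈ λ m∈ m≢h → ⊩-weaken φ⊆ψ (premises m∈ m≢h)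

⊩-cut : ∀ {n} {φ ψ : CNF n} {g h} → (∀ {A} → A ∈ φ → A ∈ ψ) →
        ψ ⊩ g → [ g ] ∷ φ ⊩ h → ψ ⊩ h
⊩-cut φ⊆ψ ψ⊩g (fire (here refl) (here refl) _) = ψ⊩g
⊩-cut φ⊆ψ ψ⊩g (fire (there A∈) h∈ premises) =
  fire (φ⊆ψ A∈) h∈ λ m∈ m≢h → ⊩-cut φ⊆ψ ψ⊩g (premises m∈ m≢h)

⊩-sound : ∀ {n} {ψ : CNF n} {α} → Satisfies α ψ → ∀ {h} → ψ ⊩ h → evalLit α h ≡ true
⊩-sound {α = α} α⊨ψ {h} (fire A∈ h∈ premises) with find (All.lookup α⊨ψ A∈)
... | m , m∈ , m-true with m ≟L h
...   | yes refl = m-true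
...   | no m≢h with trans (sym (⊩-sound α⊨ψ (premises m∈ m≢h)))
                         (trans (evalLit-compl α m) (cong not m-true))
...     | ()

⊩-consistent : ∀ {n} {ψ : CNF n} → (∃ λ α → Satisfies α ψ) →
               ∀ {h} → ψ ⊩ h → ψ ⊩ compl h → ⊥
⊩-consistent (α , α⊨ψ) {h} ψ⊩h ψ⊩¬h
  with trans (sym (⊩-sound α⊨ψ ψ⊩¬h)) (trans (evalLit-compl α h) (cong not (⊩-sound α⊨ψ ψ⊩h)))
... | ()

-- Clauses up to set equality form a decidable setoid; used to merge clauses
-- that become equal after a substitution.
sameSet? : ∀ {n} (C D : Clause n) → Dec (SameSet C D)
sameSet? C D = (_⊆?_ _≟L_ C D) ×-dec (_⊆?_ _≟L_ D C)

clauseDecSetoid : ℕ → DecSetoid 0ℓ 0ℓ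
clauseDecSetoid n = record
  { Carrier = Clause n
  ; _≈_ = SameSet
  ; isDecEquivalence = record
    { isEquivalence = record
      { refl  = (λ m∈ → m∈) , (λ m∈ → m∈)
      ; sym   = λ (C⊆D , D⊆C) → D⊆C , C⊆D
      ; trans = λ (C⊆D , D⊆C) (D⊆E , E⊆D) → (λ m∈ → D⊆E (C⊆D m∈)) , (λ m∈ → D⊆C (E⊆D m∈))
      }
    ; _≟_ = sameSet?
    }
  }

module _ {n : ℕ} where
  open DecMembership (_≟L_ {n}) using (_∈?_)

  ∉-remove⇒≡ : ∀ {m c : Lit n} {E} → m ∈ E → m ∉ remove c E → m ≡ c
  ∉-remove⇒≡ {m} {c} m∈E m∉ with m ≟L c
  ... | yes m≡c = m≡c
  ... | no m≢c  = ⊥-elim (m∉ (∈-filter⁺ (λ z → ¬? (z ≟L c)) m∈E m≢c))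

  -- Every clause obtained by unit resolution is a residual: a subclause of some
  -- clause of ψ whose deleted literals all have propagated complements.
  record Residual (ψ : CNF n) (E : Clause n) : Set where
    field
      origin    : Clause n
      origin∈ψ  : origin ∈ ψ
      E⊆origin  : E ⊆C origin
      refuted   : ∀ {m} → m ∈ origin → m ∉ E → ψ ⊩ compl m

  unit-residual⇒⊩ : ∀ {ψ h} → Residual ψ [ h ] → ψ ⊩ h
  unit-residual⇒⊩ r = fire origin∈ψ (E⊆origin (here refl))
                         λ m∈ m≢h → refuted m∈ λ { (here m≡h) → m≢h m≡h }
    where open Residual r

  derives⇒residual : ∀ {ψ E} → Derives ψ E → Residual ψ E
  derives⇒residual (axiom C∈ψ) =
    record { origin = _ ; origin∈ψ = C∈ψ ; E⊆origin = λ m∈ → m∈ ; refuted = λ m∈ m∉ → ⊥-elim (m∉ m∈) }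
  derives⇒residual {ψ} (resolve {l} {C} ⊢l ⊢C ¬l∈C) = record
    { origin = origin ; origin∈ψ = origin∈ψ
    ; E⊆origin = λ m∈ → E⊆origin (proj₁ (∈-filter⁻ (λ z → ¬? (z ≟L compl l)) {xs = C} m∈))
    ; refuted = refuted′ }
    where
    open Residual (derives⇒residual ⊢C)
    refuted′ : ∀ {m} → m ∈ origin → m ∉ remove (compl l) C → ψ ⊩ compl m
    refuted′ {m} m∈A m∉ with m ∈? C
    ... | no m∉C = refuted m∈A m∉C
    ... | yes m∈C rewrite ∉-remove⇒≡ m∈C m∉ | compl-involutive l =
      unit-residual⇒⊩ (derives⇒residual ⊢l)

  derives⇒⊩ : ∀ {ψ h} → Derives ψ [ h ] → ψ ⊩ h
  derives⇒⊩ ⊢h = unit-residual⇒⊩ (derives⇒residual ⊢h)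

  resolve-away : ∀ {ψ r E} → Derives ψ [ compl r ] → Derives ψ E → Derives ψ (remove r E)
  resolve-away {ψ} {r} {E} ⊢¬r ⊢E with r ∈? E
  ... | yes r∈E = subst (λ c → Derives ψ (remove c E)) (compl-involutive r)
                    (resolve ⊢¬r ⊢E (subst (_∈ E) (sym (compl-involutive r)) r∈E))
  ... | no r∉E  = subst (Derives ψ) (sym (ListP.filter-all (λ z → ¬? (z ≟L r)) r∉E-all)) ⊢E
    where r∉E-all : All (λ m → ¬ m ≡ r) E
          r∉E-all = All.tabulate λ m∈ m≡r → r∉E (subst (_∈ E) m≡r m∈)

  removeAll : Clause n → Clause n → Clause n
  removeAll R E = foldr remove E R

  resolve-all : ∀ {ψ E} R → All (λ r → Derives ψ [ compl r ]) R → Derives ψ E → Derives ψ (removeAll R E)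
  resolve-all []      []          ⊢E = ⊢E
  resolve-all (r ∷ R) (⊢¬r ∷ ⊢¬R) ⊢E = resolve-away ⊢¬r (resolve-all R ⊢¬R ⊢E)

  ∈-removeAll⁻ : ∀ {m E} R → m ∈ removeAll R E → m ∈ E × m ∉ R
  ∈-removeAll⁻ []            m∈ = m∈ , λ ()
  ∈-removeAll⁻ {E = E} (r ∷ R) m∈ with ∈-filter⁻ (λ z → ¬? (z ≟L r)) {xs = removeAll R E} m∈
  ... | m∈′ , m≢r with ∈-removeAll⁻ R m∈′
  ...   | m∈E , m∉R = m∈E , λ { (here m≡r) → m≢r m≡r ; (there m∈R) → m∉R m∈R }

  ∈-removeAll⁺ : ∀ {m E} R → m ∈ E → m ∉ R → m ∈ removeAll R E
  ∈-removeAll⁺ []      m∈E m∉R = m∈E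
  ∈-removeAll⁺ (r ∷ R) m∈E m∉R =
    ∈-filter⁺ (λ z → ¬? (z ≟L r)) (∈-removeAll⁺ R m∈E (λ m∈R → m∉R (there m∈R))) (λ m≡r → m∉R (here m≡r))

  unique-removeAll : ∀ {E} R → Unique E → Unique (removeAll R E)
  unique-removeAll []      u = u
  unique-removeAll (r ∷ R) u = UniqueP.filter⁺ (λ z → ¬? (z ≟L r)) (unique-removeAll R u)

  unique-singleton : ∀ {h : Lit n} {E} → Unique E → h ∈ E → (∀ {m} → m ∈ E → m ≡ h) → E ≡ [ h ]
  unique-singleton {E = a ∷ []} _ _ all≡h rewrite all≡h (here refl) = refl
  unique-singleton {E = a ∷ b ∷ E} ((a≢b ∷ _) ∷ _) _ all≡h =
    ⊥-elim (a≢b (trans (all≡h (here refl)) (sym (all≡h (there (here refl))))))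

  -- Conversely, over duplicate-free clauses a propagation tree yields a derivation:
  -- resolve away all literals other than h from the clause that fires.
  ⊩⇒derives : ∀ {ψ} → All Unique ψ → ∀ {h} → ψ ⊩ h → Derives ψ [ h ]
  ⊩⇒derives {ψ} uniq {h} (fire {A} A∈ψ h∈A premises) =
    subst (Derives ψ) only-h (resolve-all others (All.tabulate refute) (axiom A∈ψ))
    where
    others : Clause n
    others = remove h A
    refute : ∀ {r} → r ∈ others → Derives ψ [ compl r ]
    refute r∈ with ∈-filter⁻ (λ z → ¬? (z ≟L h)) {xs = A} r∈
    ... | r∈A , r≢h = ⊩⇒derives uniq (premises r∈A r≢h)
    h∉others : h ∉ others
    h∉others h∈ = proj₂ (∈-filter⁻ (λ z → ¬? (z ≟L h)) {xs = A} h∈) refl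
    only-h : removeAll others A ≡ [ h ]
    only-h = unique-singleton (unique-removeAll others (All.lookup uniq A∈ψ))
               (∈-removeAll⁺ others h∈A h∉others)
               λ m∈ → let m∈A , m∉others = ∈-removeAll⁻ others m∈ in ∉-remove⇒≡ m∈A m∉others

all-or-witness : ∀ {X : Set} {P : X → Set} {W : Set} (A : List X) →
                 (∀ {m} → m ∈ A → P m ⊎ W) → (∀ {m} → m ∈ A → P m) ⊎ W
all-or-witness A each =
  Sum.map₁ All.lookup (All.sequenceA 0ℓ (SumRight.applicative _ _) (All.tabulate each))

length≡1 : ∀ {A : Set} (xs : List A) → length xs ≡ 1 → Σ A λ c → xs ≡ [ c ]
length≡1 (c ∷ []) _ = c , refl

sole-survivor : ∀ {A : Set} {P : A → Set} (P? : Decidable P) (xs : List A) {c : A} →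
                filter P? xs ≡ [ c ] → c ∈ xs × P c × (∀ {a} → a ∈ xs → P a → a ≡ c)
sole-survivor {P = P} P? xs {c} filtered≡[c] =
  proj₁ (∈-filter⁻ P? c∈filtered) , proj₂ (∈-filter⁻ P? {xs = xs} c∈filtered) , only
  where
  c∈filtered : c ∈ filter P? xs
  c∈filtered = subst (c ∈_) (sym filtered≡[c]) (here refl)
  only : ∀ {a} → a ∈ xs → P a → a ≡ c
  only a∈xs Pa with subst (_ ∈_) filtered≡[c] (∈-filter⁺ P? a∈xs Pa)
  ... | here a≡c = a≡c

third : ∀ {n} → 3 ≤ n → (a b : Fin n) → Σ (Fin n) λ j → j ≢ a × j ≢ b
third (s≤s (s≤s (s≤s _))) a b with Fin.zero Fin.≟ a | Fin.zero Fin.≟ b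
... | no 0≢a | no 0≢b = Fin.zero , 0≢a , 0≢b
... | yes refl | _ with Fin.suc Fin.zero Fin.≟ b
...   | no 1≢b   = Fin.suc Fin.zero , (λ ()) , 1≢b
...   | yes refl = Fin.suc (Fin.suc Fin.zero) , (λ ()) , (λ ())
third (s≤s (s≤s (s≤s _))) a b | no _ | yes refl with Fin.suc Fin.zero Fin.≟ a
...   | no 1≢a   = Fin.suc Fin.zero , 1≢a , (λ ())
...   | yes refl = Fin.suc (Fin.suc Fin.zero) , (λ ()) , (λ ())

Tautology : ∀ {n} → Clause n → Set
Tautology D = Any (λ m → compl m ∈ D) D

tautology? : ∀ {n} (D : Clause n) → Dec (Tautology D)
tautology? {n} D = any? (λ m → DecMembership._∈?_ (_≟L_ {n}) (compl m) D) D

non-tautology? : ∀ {n} (D : Clause n) → Dec (¬ Tautology D)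
non-tautology? D = ¬? (tautology? D)

Improvement : ∀ {n} → CNF n → Set
Improvement {n} φ = Σ (CNF n) λ φ′ → WF φ′ × IsPEncoding φ′ × (size φ′ + 1 ≤ size φ) × (Is2CNF φ → Is2CNF φ′)

module SingleOccurrence
  {n : ℕ} (φ : CNF n) (wf : WF φ) (i : Fin n) (C : Clause n) (C∈φ : C ∈ φ)
  (¬xᵢ∈C : neg (inj₁ i) ∈ C) (only-C : ∀ {A} → A ∈ φ → neg (inj₁ i) ∈ A → A ≡ C)
  (sat : ∀ k → SatWith φ (x k))
  (excl : ∀ j k → j ≢ k → [ x j ] ∷ φ ⊩ neg (inj₁ k)) where

  open DecMembership (_≟L_ {n}) using (_∈?_)

  xᵢ ¬xᵢ : Lit n
  xᵢ  = x i
  ¬xᵢ = neg (inj₁ i)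

  ψ : Fin n → CNF n
  ψ k = [ x k ] ∷ φ

  ψ-consistent : ∀ k {h} → ψ k ⊩ h → ψ k ⊩ compl h → ⊥
  ψ-consistent k = ⊩-consistent (sat k)

  non-complementary : ∀ {A} → A ∈ φ → ∀ {m} → m ∈ A → compl m ∈ A → ⊥
  non-complementary A∈φ = proj₂ (All.lookup (proj₁ wf) A∈φ)

  -- ¬xᵢ can only be propagated by C, which then refutes every other literal of C.
  ¬xᵢ-via-C : ∀ {k l} → l ∈ C → l ≢ ¬xᵢ → ψ k ⊩ ¬xᵢ → ψ k ⊩ compl l
  ¬xᵢ-via-C l∈C l≢¬xᵢ (fire (here refl) (here ()) _)
  ¬xᵢ-via-C l∈C l≢¬xᵢ (fire (there A∈φ) ¬xᵢ∈A premises) with only-C A∈φ ¬xᵢ∈A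
  ... | refl = premises l∈C l≢¬xᵢ

  -- A firing of a clause of φ for h either uses C for a literal other than ¬xᵢ,
  -- or is "xᵢ-free": ¬xᵢ occurs in the clause only as h itself.
  classify : ∀ {A} → A ∈ φ → (h : Lit n) → (A ≡ C × h ≢ ¬xᵢ) ⊎ (¬xᵢ ∈ A → h ≡ ¬xᵢ)
  classify {A} A∈φ h with ¬xᵢ ∈? A | h ≟L ¬xᵢ
  ... | yes ¬xᵢ∈A | no h≢¬xᵢ  = inj₁ (only-C A∈φ ¬xᵢ∈A , h≢¬xᵢ)
  ... | yes _     | yes h≡¬xᵢ = inj₂ λ _ → h≡¬xᵢ
  ... | no ¬xᵢ∉A  | _         = inj₂ λ ¬xᵢ∈A → ⊥-elim (¬xᵢ∉A ¬xᵢ∈A)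

  premise-≢xᵢ : ∀ {A h m} → (¬xᵢ ∈ A → h ≡ ¬xᵢ) → m ∈ A → m ≢ h → compl m ≢ xᵢ
  premise-≢xᵢ {A} xᵢ-free m∈A m≢h ¬m≡xᵢ with compl-injective {b = ¬xᵢ} ¬m≡xᵢ
  ... | refl = m≢h (sym (xᵢ-free m∈A))

  record Witness : Set where
    constructor witness
    field
      lit        : Lit n
      lit∈C      : lit ∈ C
      lit≢¬xᵢ    : lit ≢ ¬xᵢ
      propagated : ψ i ⊩ lit

  trichotomy : ∀ {h} → ψ i ⊩ h → φ ⊩ h ⊎ h ≡ xᵢ ⊎ Witness
  trichotomy (fire (here refl) (here refl) _) = inj₂ (inj₁ refl)
  trichotomy {h} (fire {A} (there A∈φ) h∈A premises) with classify A∈φ h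
  ... | inj₁ (refl , h≢¬xᵢ) = inj₂ (inj₂ (witness h h∈A h≢¬xᵢ (fire (there A∈φ) h∈A premises)))
  ... | inj₂ xᵢ-free =
    Sum.map (fire A∈φ h∈A) inj₂ (all-or-witness A premise)
    where
    premise : ∀ {m} → m ∈ A → (m ≢ h → φ ⊩ compl m) ⊎ Witness
    premise {m} m∈A with m ≟L h
    ... | yes m≡h = inj₁ λ m≢h → ⊥-elim (m≢h m≡h)
    ... | no m≢h with trichotomy (premises m∈A m≢h)
    ...   | inj₁ φ⊩¬m        = inj₁ λ _ → φ⊩¬m
    ...   | inj₂ (inj₁ ¬m≡xᵢ) = ⊥-elim (premise-≢xᵢ xᵢ-free m∈A m≢h ¬m≡xᵢ)
    ...   | inj₂ (inj₂ w)     = inj₂ w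

  -- Since xᵢ excludes another input, which φ alone cannot refute, a witness exists.
  witness-exists : (j : Fin n) → j ≢ i → Witness
  witness-exists j j≢i with trichotomy (excl i j (j≢i ∘ sym))
  ... | inj₁ φ⊩¬xⱼ  = ⊥-elim (ψ-consistent j (⊩-unit (x j)) (⊩-weaken there φ⊩¬xⱼ))
  ... | inj₂ (inj₁ ())
  ... | inj₂ (inj₂ w) = w

  reroute : ∀ {l} → l ∈ C → ψ i ⊩ l → ∀ {h} → ψ i ⊩ h → h ≡ xᵢ ⊎ [ l ] ∷ φ ⊩ h
  reroute l∈C ψᵢ⊩l (fire (here refl) (here refl) _) = inj₁ refl
  reroute {l} l∈C ψᵢ⊩l {h} (fire (there A∈φ) h∈A premises) with classify A∈φ h
  ... | inj₁ (refl , h≢¬xᵢ) with h ≟L l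
  ...   | yes refl = inj₂ (⊩-unit l)
  ...   | no h≢l   = ⊥-elim (ψ-consistent i ψᵢ⊩l (premises l∈C (h≢l ∘ sym)))
  reroute l∈C ψᵢ⊩l {h} (fire (there A∈φ) h∈A premises) | inj₂ xᵢ-free =
    inj₂ (fire (there A∈φ) h∈A λ m∈A m≢h →
      [ (λ ¬m≡xᵢ → ⊥-elim (premise-≢xᵢ xᵢ-free m∈A m≢h ¬m≡xᵢ)) , id ]′
        (reroute l∈C ψᵢ⊩l (premises m∈A m≢h)))

  -- With n ≥ 3 a witness is an auxiliary literal: an input literal xₖ would clash
  -- with ¬xₖ, and ¬xₖ would let a third input xⱼ refute itself.
  witness-aux : 3 ≤ n → ∀ {l} → l ∈ C → l ≢ ¬xᵢ → ψ i ⊩ l → IsAux l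
  witness-aux _ {pos (inj₂ _)} _ _ _ _ ()
  witness-aux _ {neg (inj₂ _)} _ _ _ _ ()
  witness-aux _ {pos (inj₁ k)} l∈C _ ψᵢ⊩xₖ k refl with k Fin.≟ i
  ... | yes refl = non-complementary C∈φ l∈C ¬xᵢ∈C
  ... | no k≢i   = ψ-consistent i ψᵢ⊩xₖ (excl i k (k≢i ∘ sym))
  witness-aux 3≤n {neg (inj₁ k)} l∈C l≢¬xᵢ ψᵢ⊩l k refl with k Fin.≟ i
  ... | yes refl = l≢¬xᵢ refl
  ... | no k≢i with third 3≤n i k
  ...   | j , j≢i , j≢k with reroute l∈C ψᵢ⊩l (excl i j (j≢i ∘ sym))
  ...     | inj₁ ()
  ...     | inj₂ l,φ⊩¬xⱼ = ψ-consistent j (⊩-unit (x j)) (⊩-cut there (excl j k j≢k) l,φ⊩¬xⱼ)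

  module Elimination (l : Lit n) (l∈C : l ∈ C) (l≢¬xᵢ : l ≢ ¬xᵢ) (ψᵢ⊩l : ψ i ⊩ l)
                     (l-aux : IsAux l) where

    τ : Lit n → Lit n
    τ m with m ≟L l
    ... | yes _ = xᵢ
    ... | no _ with m ≟L compl l
    ...   | yes _ = ¬xᵢ
    ...   | no _  = m

    τ-l : τ l ≡ xᵢ
    τ-l with l ≟L l
    ... | yes _   = refl
    ... | no l≢l  = ⊥-elim (l≢l refl)

    τ-¬l : τ (compl l) ≡ ¬xᵢ
    τ-¬l with compl l ≟L l
    ... | yes ¬l≡l = ⊥-elim (compl-≢ l ¬l≡l)
    ... | no _ with compl l ≟L compl l
    ...   | yes _    = refl
    ...   | no ¬l≢¬l = ⊥-elim (¬l≢¬l refl)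

    τ-fixed : ∀ {m} → m ≢ l → m ≢ compl l → τ m ≡ m
    τ-fixed {m} m≢l m≢¬l with m ≟L l
    ... | yes m≡l = ⊥-elim (m≢l m≡l)
    ... | no _ with m ≟L compl l
    ...   | yes m≡¬l = ⊥-elim (m≢¬l m≡¬l)
    ...   | no _     = refl

    τ-input : ∀ {m k} → var m ≡ inj₁ k → τ m ≡ m
    τ-input {m} {k} var≡ = τ-fixed
      (λ m≡l → l-aux k (trans (cong var (sym m≡l)) var≡))
      (λ m≡¬l → l-aux k (trans (sym (var-compl l)) (trans (cong var (sym m≡¬l)) var≡)))

    position : ∀ m → m ≡ l ⊎ m ≡ compl l ⊎ (m ≢ l × m ≢ compl l)
    position m with m ≟L l
    ... | yes m≡l = inj₁ m≡l
    ... | no m≢l with m ≟L compl l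
    ...   | yes m≡¬l = inj₂ (inj₁ m≡¬l)
    ...   | no m≢¬l  = inj₂ (inj₂ (m≢l , m≢¬l))

    τ-compl : ∀ m → τ (compl m) ≡ compl (τ m)
    τ-compl m with position m
    ... | inj₁ refl = trans τ-¬l (cong compl (sym τ-l))
    ... | inj₂ (inj₁ refl) = trans (cong τ (compl-involutive l)) (trans τ-l (cong compl (sym τ-¬l)))
    ... | inj₂ (inj₂ (m≢l , m≢¬l)) =
      trans (τ-fixed (λ ¬m≡l → m≢¬l (trans (sym (compl-involutive m)) (cong compl ¬m≡l)))
                     (λ ¬m≡¬l → m≢l (compl-injective ¬m≡¬l)))
            (cong compl (sym (τ-fixed m≢l m≢¬l)))

    data Image (m : Lit n) : Set where
      to-xᵢ  : m ≡ xᵢ ⊎ m ≡ l → τ m ≡ xᵢ → Image m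
      to-¬xᵢ : m ≡ ¬xᵢ ⊎ m ≡ compl l → τ m ≡ ¬xᵢ → Image m
      fixed  : m ≢ xᵢ → m ≢ ¬xᵢ → τ m ≡ m → Image m

    image : ∀ m → Image m
    image m with position m
    ... | inj₁ refl = to-xᵢ (inj₂ refl) τ-l
    ... | inj₂ (inj₁ refl) = to-¬xᵢ (inj₂ refl) τ-¬l
    ... | inj₂ (inj₂ (m≢l , m≢¬l)) with m ≟L xᵢ
    ...   | yes refl = to-xᵢ (inj₁ refl) (τ-input refl)
    ...   | no m≢xᵢ with m ≟L ¬xᵢ
    ...     | yes refl = to-¬xᵢ (inj₁ refl) (τ-input refl)
    ...     | no m≢¬xᵢ = fixed m≢xᵢ m≢¬xᵢ (τ-fixed m≢l m≢¬l)

    clash : ∀ {A a b} → A ∈ φ → ¬xᵢ ∉ A → a ∈ A → b ∈ A → τ b ≡ compl (τ a) →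
            xᵢ ∈ A × compl l ∈ A
    clash {A} {a} {b} A∈φ ¬xᵢ∉A a∈A b∈A τb≡¬τa with image a | image b
    ... | to-xᵢ _ τa≡xᵢ | to-xᵢ _ τb≡xᵢ with trans (sym τb≡xᵢ) (trans τb≡¬τa (cong compl τa≡xᵢ))
    ...   | ()
    clash A∈φ ¬xᵢ∉A a∈A b∈A _ | to-xᵢ (inj₁ refl) _ | to-¬xᵢ (inj₂ refl) _ = a∈A , b∈A
    clash A∈φ ¬xᵢ∉A a∈A b∈A _ | to-xᵢ (inj₂ refl) _ | to-¬xᵢ (inj₂ refl) _ =
      ⊥-elim (non-complementary A∈φ a∈A b∈A)
    clash A∈φ ¬xᵢ∉A a∈A b∈A _ | to-xᵢ _ _ | to-¬xᵢ (inj₁ refl) _ = ⊥-elim (¬xᵢ∉A b∈A)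
    clash A∈φ ¬xᵢ∉A a∈A b∈A τb≡¬τa | to-xᵢ _ τa≡xᵢ | fixed _ b≢¬xᵢ τb≡b =
      ⊥-elim (b≢¬xᵢ (trans (sym τb≡b) (trans τb≡¬τa (cong compl τa≡xᵢ))))
    clash A∈φ ¬xᵢ∉A a∈A b∈A _ | to-¬xᵢ (inj₁ refl) _ | _ = ⊥-elim (¬xᵢ∉A a∈A)
    clash A∈φ ¬xᵢ∉A a∈A b∈A _ | to-¬xᵢ (inj₂ refl) _ | to-xᵢ (inj₁ refl) _ = b∈A , a∈A
    clash A∈φ ¬xᵢ∉A a∈A b∈A _ | to-¬xᵢ (inj₂ refl) _ | to-xᵢ (inj₂ refl) _ =
      ⊥-elim (non-complementary A∈φ b∈A a∈A)
    clash A∈φ ¬xᵢ∉A a∈A b∈A τb≡¬τa | to-¬xᵢ _ τa≡¬xᵢ | to-¬xᵢ _ τb≡¬xᵢ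
      with trans (sym τb≡¬xᵢ) (trans τb≡¬τa (cong compl τa≡¬xᵢ))
    ... | ()
    clash A∈φ ¬xᵢ∉A a∈A b∈A τb≡¬τa | to-¬xᵢ _ τa≡¬xᵢ | fixed b≢xᵢ _ τb≡b =
      ⊥-elim (b≢xᵢ (trans (sym τb≡b) (trans τb≡¬τa (cong compl τa≡¬xᵢ))))
    clash A∈φ ¬xᵢ∉A a∈A b∈A τb≡¬τa | fixed a≢xᵢ a≢¬xᵢ τa≡a | to-xᵢ _ τb≡xᵢ =
      ⊥-elim (a≢¬xᵢ (compl-injective (trans (sym (trans τb≡¬τa (cong compl τa≡a))) τb≡xᵢ)))
    clash A∈φ ¬xᵢ∉A a∈A b∈A τb≡¬τa | fixed a≢xᵢ a≢¬xᵢ τa≡a | to-¬xᵢ _ τb≡¬xᵢ =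
      ⊥-elim (a≢xᵢ (compl-injective (trans (sym (trans τb≡¬τa (cong compl τa≡a))) τb≡¬xᵢ)))
    clash {A} A∈φ ¬xᵢ∉A a∈A b∈A τb≡¬τa | fixed _ _ τa≡a | fixed _ _ τb≡b =
      ⊥-elim (non-complementary A∈φ a∈A
               (subst (_∈ A) (trans (sym τb≡b) (trans τb≡¬τa (cong compl τa≡a))) b∈A))

    -- The clauses of φ other than C are those avoiding ¬xᵢ.
    avoids? : (A : Clause n) → Dec (¬xᵢ ∉ A)
    avoids? A = ¬? (¬xᵢ ∈? A)

    τC : Clause n → Clause n
    τC A = deduplicate _≟L_ (map τ A)

    φ₁ : CNF n
    φ₁ = filter non-tautology? (map τC (filter avoids? φ))

    φ′ : CNF n
    φ′ = deduplicate sameSet? φ₁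

    ∈τC⁺ : ∀ {A m} → m ∈ A → τ m ∈ τC A
    ∈τC⁺ m∈A = ∈-deduplicate⁺ _≟L_ (∈-map⁺ τ m∈A)

    ∈τC⁻ : ∀ {A m′} → m′ ∈ τC A → Σ (Lit n) λ m → m ∈ A × m′ ≡ τ m
    ∈τC⁻ {A} m′∈ = ∈-map⁻ τ (∈-deduplicate⁻ _≟L_ (map τ A) m′∈)

    data Origin : Clause n → Set where
      origin : ∀ {A} → A ∈ φ → ¬xᵢ ∉ A → ¬ Tautology (τC A) → Origin (τC A)

    origin-of : ∀ {D} → D ∈ φ′ → Origin D
    origin-of D∈φ′ with ∈-filter⁻ non-tautology? (∈-deduplicate⁻ sameSet? φ₁ D∈φ′)
    ... | D∈ , non-taut with ∈-map⁻ τC D∈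
    ...   | A , A∈ , refl with ∈-filter⁻ avoids? A∈
    ...     | A∈φ , ¬xᵢ∉A = origin A∈φ ¬xᵢ∉A non-taut

    representative : ∀ {A} → A ∈ φ → ¬xᵢ ∉ A → ¬ Tautology (τC A) →
                     Σ (Clause n) λ D → D ∈ φ′ × SameSet D (τC A)
    representative A∈φ ¬xᵢ∉A non-taut =
      let τA∈φ₁ = ∈-filter⁺ non-tautology? (∈-map⁺ τC (∈-filter⁺ avoids? A∈φ ¬xᵢ∉A)) non-taut
      in  find (AnyP.deduplicate⁺ sameSet? ≈-trans (Any.map (λ τA≡D → ≈-reflexive (sym τA≡D)) τA∈φ₁))
      where open DecSetoid (clauseDecSetoid n) using () renaming (trans to ≈-trans; reflexive to ≈-reflexive)

    φ′-wf : WF φ′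
    φ′-wf = All.tabulate (clause-wf ∘ origin-of) , UniqueDS.deduplicate-! (clauseDecSetoid n) φ₁
      where clause-wf : ∀ {D} → Origin D → WFClause D
            clause-wf (origin {A} _ _ non-taut) =
              UniqueDP.deduplicate-! _≟L_ (map τ A) , λ m∈ ¬m∈ → non-taut (lose m∈ ¬m∈)

    φ′-2cnf : Is2CNF φ → Is2CNF φ′
    φ′-2cnf φ-2cnf = All.tabulate (short ∘ origin-of)
      where short : ∀ {D} → Origin D → length D ≤ 2
            short (origin {A} A∈φ _ _) = begin
              length (τC A)      ≤⟨ ListP.length-deduplicate _≟L_ (map τ A) ⟩
              length (map τ A)   ≡⟨ ListP.length-map τ A ⟩
              length A           ≤⟨ All.lookup φ-2cnf A∈φ ⟩
              2                  ∎
              where open ℕP.≤-Reasoning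

    φ′-smaller : size φ′ + 1 ≤ size φ
    φ′-smaller = begin
      length φ′ + 1                              ≡⟨ ℕP.+-comm (length φ′) 1 ⟩
      suc (length φ′)                            ≤⟨ s≤s (ListP.length-deduplicate sameSet? φ₁) ⟩
      suc (length φ₁)                            ≤⟨ s≤s (ListP.length-filter non-tautology? (map τC (filter avoids? φ))) ⟩
      suc (length (map τC (filter avoids? φ)))   ≡⟨ cong suc (ListP.length-map τC (filter avoids? φ)) ⟩
      suc (length (filter avoids? φ))            ≤⟨ ListP.filter-notAll avoids? φ C-rejected ⟩
      length φ                                   ∎
      where open ℕP.≤-Reasoning
            C-rejected : Any (λ A → ¬ (¬xᵢ ∉ A)) φ
            C-rejected = Any.map (λ { refl ¬xᵢ∉C → ¬xᵢ∉C ¬xᵢ∈C }) C∈φ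

    xᵢ⇒l : ∀ k → ψ k ⊩ xᵢ → ψ k ⊩ l
    xᵢ⇒l k with k Fin.≟ i
    ... | yes refl = λ _ → ψᵢ⊩l
    ... | no k≢i   = λ ψₖ⊩xᵢ → ⊥-elim (ψ-consistent k ψₖ⊩xᵢ (excl k i k≢i))

    module Model (k : Fin n) where
      α : Assignment n
      α = proj₁ (sat k)

      α′ : Assignment n
      α′ v with v ≟V inj₁ i
      ... | yes _ = evalLit α l
      ... | no _  = α v

      α′-xᵢ : evalLit α′ xᵢ ≡ evalLit α l
      α′-xᵢ with inj₁ {B = ℕ} i ≟V inj₁ i
      ... | yes _   = refl
      ... | no i≢i  = ⊥-elim (i≢i refl)

      α′-agrees : ∀ {m} → m ≢ xᵢ → m ≢ ¬xᵢ → evalLit α′ m ≡ evalLit α m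
      α′-agrees {pos v} m≢xᵢ _ with v ≟V inj₁ i
      ... | yes refl = ⊥-elim (m≢xᵢ refl)
      ... | no _     = refl
      α′-agrees {neg v} _ m≢¬xᵢ with v ≟V inj₁ i
      ... | yes refl = ⊥-elim (m≢¬xᵢ refl)
      ... | no _     = refl

      α⊨ : Satisfies α (ψ k)
      α⊨ = proj₂ (sat k)

      α-xᵢ⇒l : evalLit α xᵢ ≡ true → evalLit α l ≡ true
      α-xᵢ⇒l α-xᵢ with k Fin.≟ i
      ... | yes refl = ⊩-sound α⊨ ψᵢ⊩l
      ... | no k≢i with subst (λ b → not b ≡ true) α-xᵢ (⊩-sound α⊨ (excl k i k≢i))
      ...   | ()

      transfer : ∀ {m} → m ≢ ¬xᵢ → evalLit α m ≡ true → evalLit α′ (τ m) ≡ true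
      transfer {m} m≢¬xᵢ αm with image m
      ... | to-xᵢ (inj₁ refl) τm≡xᵢ = trans (cong (evalLit α′) τm≡xᵢ) (trans α′-xᵢ (α-xᵢ⇒l αm))
      ... | to-xᵢ (inj₂ refl) τm≡xᵢ = trans (cong (evalLit α′) τm≡xᵢ) (trans α′-xᵢ αm)
      ... | to-¬xᵢ (inj₁ refl) _    = ⊥-elim (m≢¬xᵢ refl)
      ... | to-¬xᵢ (inj₂ refl) τm≡¬xᵢ = begin
        evalLit α′ (τ (compl l))   ≡⟨ cong (evalLit α′) τm≡¬xᵢ ⟩
        not (evalLit α′ xᵢ)        ≡⟨ cong not α′-xᵢ ⟩
        not (evalLit α l)          ≡⟨ sym (evalLit-compl α l) ⟩
        evalLit α (compl l)        ≡⟨ αm ⟩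
        true                       ∎
        where open ≡-Reasoning
      ... | fixed m≢xᵢ _ τm≡m = trans (cong (evalLit α′) τm≡m) (trans (α′-agrees m≢xᵢ m≢¬xᵢ) αm)

      model : SatWith φ′ (x k)
      model = α′ , here xₖ-true ∷ All.tabulate (clause-true ∘ origin-of)
        where
        xₖ-true : evalLit α′ (x k) ≡ true
        xₖ-true with All.lookup α⊨ (here refl)
        ... | here αxₖ = trans (cong (evalLit α′) (sym (τ-input {x k} refl))) (transfer {x k} (λ ()) αxₖ)
        clause-true : ∀ {D} → Origin D → Any (λ m → evalLit α′ m ≡ true) D
        clause-true (origin A∈φ ¬xᵢ∉A _) with find (All.lookup α⊨ (there A∈φ))
        ... | m , m∈A , αm = lose (∈τC⁺ m∈A) (transfer (λ m≡¬xᵢ → ¬xᵢ∉A (subst (_∈ _) m≡¬xᵢ m∈A)) αm)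

    ψ′ : Fin n → CNF n
    ψ′ k = [ x k ] ∷ φ′

    ¬l≢xᵢ : compl l ≢ xᵢ
    ¬l≢xᵢ ¬l≡xᵢ = l-aux i (trans (sym (var-compl l)) (cong var ¬l≡xᵢ))

    simulate : ∀ k {h} → ψ k ⊩ h → ψ′ k ⊩ τ h
    simulate k (fire (here refl) (here refl) _) = subst (ψ′ k ⊩_) (sym (τ-input refl)) (⊩-unit (x k))
    simulate k {h} (fire {A} (there A∈φ) h∈A premises) with ¬xᵢ ∈? A
    -- C can only propagate ¬xᵢ (mirrored via ¬l) or l (mirrored via xᵢ).
    ... | yes ¬xᵢ∈A with only-C A∈φ ¬xᵢ∈A
    ...   | refl with h ≟L ¬xᵢ
    ...     | yes refl = subst (ψ′ k ⊩_) (trans τ-¬l (sym (τ-input refl)))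
                           (simulate k (premises l∈C l≢¬xᵢ))
    ...     | no h≢¬xᵢ with position h
    ...       | inj₁ refl = subst (ψ′ k ⊩_) (trans (τ-input refl) (sym τ-l))
                              (simulate k (premises ¬xᵢ∈A (l≢¬xᵢ ∘ sym)))
    ...       | inj₂ (inj₁ refl) = ⊥-elim (non-complementary A∈φ l∈C h∈A)
    ...       | inj₂ (inj₂ (h≢l , _)) = ⊥-elim (ψ-consistent k (xᵢ⇒l k (premises ¬xᵢ∈A (h≢¬xᵢ ∘ sym)))
                                                           (premises l∈C (h≢l ∘ sym)))
    -- A clause whose image is a tautology contains xᵢ and ¬l, so it can only
    -- propagate xᵢ (mirrored via l) or ¬l (mirrored via ¬xᵢ).
    simulate k {h} (fire {A} (there A∈φ) h∈A premises) | no ¬xᵢ∉A with tautology? (τC A)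
    ... | yes taut with find taut
    ...   | _ , m′∈ , ¬m′∈ with ∈τC⁻ m′∈ | ∈τC⁻ ¬m′∈
    ...     | a , a∈A , refl | b , b∈A , ¬τa≡τb with clash A∈φ ¬xᵢ∉A a∈A b∈A (sym ¬τa≡τb)
    ...       | xᵢ∈A , ¬l∈A with h ≟L xᵢ
    ...         | yes refl = subst (ψ′ k ⊩_)
                               (trans (cong τ (compl-involutive l)) (trans τ-l (sym (τ-input refl))))
                               (simulate k (premises ¬l∈A ¬l≢xᵢ))
    ...         | no h≢xᵢ with position h
    ...           | inj₁ refl = ⊥-elim (non-complementary A∈φ h∈A ¬l∈A)
    ...           | inj₂ (inj₁ refl) = subst (ψ′ k ⊩_) (trans (τ-input refl) (sym τ-¬l))
                                         (simulate k (premises xᵢ∈A (¬l≢xᵢ ∘ sym)))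
    ...           | inj₂ (inj₂ (_ , h≢¬l)) = ⊥-elim (ψ-consistent k
                                (subst (ψ k ⊩_) (compl-involutive l) (premises ¬l∈A (h≢¬l ∘ sym)))
                                (¬xᵢ-via-C l∈C l≢¬xᵢ (premises xᵢ∈A (h≢xᵢ ∘ sym))))
    simulate k {h} (fire {A} (there A∈φ) h∈A premises) | no ¬xᵢ∉A | no non-taut
      with representative A∈φ ¬xᵢ∉A non-taut
    ... | D , D∈φ′ , (D⊆τA , τA⊆D) = fire (there D∈φ′) (τA⊆D (∈τC⁺ h∈A)) premises′
      where
      premises′ : ∀ {m′} → m′ ∈ D → m′ ≢ τ h → ψ′ k ⊩ compl m′
      premises′ m′∈D m′≢τh with ∈τC⁻ (D⊆τA m′∈D)
      ... | m , m∈A , refl = subst (ψ′ k ⊩_) (τ-compl m) (simulate k (premises m∈A (m′≢τh ∘ cong τ)))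

    φ′-excl : ∀ j k → j ≢ k → φ′ ∧ x j ⊢₁ compl (x k)
    φ′-excl j k j≢k =
      ⊩⇒derives unique-clauses (subst (ψ′ j ⊩_) (τ-input refl) (simulate j (excl j k j≢k)))
      where unique-clauses : All Unique (ψ′ j)
            unique-clauses = ([] ∷ []) ∷ All.map proj₁ (proj₁ φ′-wf)

    improvement : Improvement φ
    improvement = φ′ , φ′-wf , ((λ k → Model.model k) , φ′-excl) , φ′-smaller , φ′-2cnf

proposition2 : (n : ℕ) → 3 ≤ n → (φ : CNF n) → WF φ → IsPEncoding φ →
               (i : Fin n) → size (Q φ i) ≡ 1 →
               Σ (CNF n) (λ φ' → WF φ' × IsPEncoding φ' ×
                 (size φ' + 1 ≤ size φ) × (Is2CNF φ → Is2CNF φ'))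
proposition2 n 3≤n φ wf (sat , excl) i |Q|≡1
  with C , Q≡[C] ← length≡1 (Q φ i) |Q|≡1
  with C∈φ , ¬xᵢ∈C , only-C ← sole-survivor (DecMembership._∈?_ _≟L_ (compl (x i))) φ Q≡[C]
  = improvement
  where
  open SingleOccurrence φ wf i C C∈φ ¬xᵢ∈C only-C sat (λ j k j≢k → derives⇒⊩ (excl j k j≢k))
  w : Witness
  w = let j , j≢i , _ = third 3≤n i i in witness-exists j j≢i
  open Witness w
  open Elimination lit lit∈C lit≢¬xᵢ propagated (witness-aux 3≤n lit∈C lit≢¬xᵢ propagated)
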